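{- Let $k\ge 0$ be an integer, let $P$ be a finite propositional logic program, and let $U$ be a set of atoms that is a model of the propositional theory $T_0(P)$ with $|M(U)|\le k$, where $M(U)=\{q\in\mathrm{At}(P)\colon c(q)\in U\}$. Let $i_U$ be the largest $i$ such that $c(q,i)\in U$ for some $q\in M(U)$ ($i_U=0$ if $M(U)=\emptyset$). Then (1) $i_U\le k$, and (2) $M(U)$ is a stable model of $P$.
   Context: A logic program is a finite set of rules $r$ of the form $q \leftarrow a_1,\ldots,a_s,\mathbf{not}(b_1),\ldots,\mathbf{not}(b_t)$ with $q,a_i,b_j$ propositional atoms; $\mathrm{At}(P)$ is the set of atoms of $P$. For $M\subseteq\mathrm{At}(P)$ the reduct $P^M$ deletes every rule having some $b_j\in M$ and deletes negated atoms from the remaining rules; $M$ is a stable model if $M$ equals the least model of $P^M$. Fix $k$. For each $q\in\mathrm{At}(P)$ introduce new propositional atoms $c(q)$, $c(q,i)$ ($1\le i\le k+1$), $c^-(q,i)$ ($2\le i\le k+1$). Let $F_1(q,i)$ ($2\le i\le k+1$) be $c^-(q,i)\Leftrightarrow c(q,1)\vee\cdots\vee c(q,i-1)$, and $F_2(q)$ be $c(q)\Leftrightarrow c(q,1)\vee\cdots\vee c(q,k+1)$. For a rule $r=q\leftarrow a_1,\ldots,a_s,\mathbf{not}(b_1),\ldots,\mathbf{not}(b_t)$ and $2\le i\le k+1$, $F_3(r,i)=c^-(a_1,i)\wedge\cdots\wedge c^-(a_s,i)\wedge\neg c(b_1)\wedge\cdots\wedge\neg c(b_t)\wedge\neg c^-(q,i)$;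 $F_3(r,1)$ is $\mathbf{false}$ if $s\ge1$ and is $\neg c(b_1)\wedge\cdots\wedge\neg c(b_t)$ if $s=0$. For $q\in\mathrm{At}(P)$ with $r_1,\ldots,r_v$ all rules of $P$ with head $q$, and $1\le i\le k+1$, $F_4(q,i)$ is $c(q,i)\Leftrightarrow F_3(r_1,i)\vee\cdots\vee F_3(r_v,i)$ (empty disjunction is false). $T_0(P)=\{F_1(q,i)\colon q\in\mathrm{At}(P),2\le i\le k+1\}\cup\{F_2(q)\colon q\in\mathrm{At}(P)\}\cup\{F_4(q,i)\colon q\in\mathrm{At}(P),1\le i\le k+1\}$. A set of atoms $U$ is a model if the valuation making exactly the atoms of $U$ true satisfies every formula. -}

module Defs where

open import Data.Nat using (ℕ; zero; suc; _+_; _≡ᵇ_; _⊔_)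
open import Data.Bool using (Bool; true; false; _∧_; _∨_; not; if_then_else_)
open import Data.List using (List; []; _∷_; map; filter; concatMap; foldr; upTo; length; deduplicate; _++_)
open import Data.Bool.ListAction using (any; all)
open import Data.List.Relation.Unary.All using (All)
open import Data.List.Membership.Propositional using (_∈_)
open import Relation.Binary.PropositionalEquality using (_≡_)
open import Data.Nat.Properties using (_≟_)
open import Function.Bundles using (_⇔_)

Atom : Set
Atom = ℕ

record Rule : Set where
  constructor _←_∣_
  field
    head : Atom
    pos  : List Atom
    neg  : List Atom
open Rule public

Program : Set
Program = List Rule

-- At(P): all atoms occurring in P (possibly with repetitions)
At : Program → List Atom
At P = concatMap (λ r → head r ∷ pos r ++ neg r) P

_∈ᵇ_ : Atom → List Atom → Bool
q ∈ᵇ xs = any (λ x → x ≡ᵇ q) xs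

AtomSet : Set
AtomSet = Atom → Bool

record PosRule : Set where
  constructor _⇐_
  field
    phead : Atom
    body  : List Atom
open PosRule public

reduct : Program → AtomSet → List PosRule
reduct P M = map (λ r → head r ⇐ pos r)
                 (filter (λ r → Data.Bool.T? (all (λ b → not (M b)) (neg r))) P)
  where import Data.Bool

data LeastModel (Q : List PosRule) : Atom → Set where
  byRule : ∀ {r} → r ∈ Q → All (LeastModel Q) (body r) → LeastModel Q (phead r)

StableModel : Program → AtomSet → Set
StableModel P M = ∀ q → (M q ≡ true) ⇔ LeastModel (reduct P M) q

-- The new atoms c(q), c(q,i), c⁻(q,i)
data CAtom : Set where
  c  : Atom → CAtom
  ci : Atom → ℕ → CAtom
  cm : Atom → ℕ → CAtom

data Form : Set where
  var   : CAtom → Form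
  ⊤f ⊥f : Form
  ¬f_   : Form → Form
  _∧f_ _∨f_ _⇔f_ : Form → Form → Form

⋀ : List Form → Form
⋀ = foldr _∧f_ ⊤f

⋁ : List Form → Form
⋁ = foldr _∨f_ ⊥f

Valuation : Set
Valuation = CAtom → Bool

⟦_⟧ : Form → Valuation → Bool
⟦ var x ⟧ U = U x
⟦ ⊤f ⟧ U = true
⟦ ⊥f ⟧ U = false
⟦ ¬f F ⟧ U = not (⟦ F ⟧ U)
⟦ F ∧f G ⟧ U = ⟦ F ⟧ U ∧ ⟦ G ⟧ U
⟦ F ∨f G ⟧ U = ⟦ F ⟧ U ∨ ⟦ G ⟧ U
⟦ F ⇔f G ⟧ U = if ⟦ F ⟧ U then ⟦ G ⟧ U else not (⟦ G ⟧ U)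

from_count_ : ℕ → ℕ → List ℕ
from a count n = map (a +_) (upTo n)

F₁ : Atom → ℕ → Form
F₁ q i = var (cm q i) ⇔f ⋁ (map (λ j → var (ci q j)) (from 1 count (i Data.Nat.∸ 1)))
  where import Data.Nat

F₂ : ℕ → Atom → Form
F₂ k q = var (c q) ⇔f ⋁ (map (λ j → var (ci q j)) (from 1 count (suc k)))

F₃ : Rule → ℕ → Form
F₃ (q ← []      ∣ bs) (suc zero) = ⋀ (map (λ b → ¬f var (c b)) bs)
F₃ (q ← (_ ∷ _) ∣ bs) (suc zero) = ⊥f
F₃ (q ← as ∣ bs) i =
  ⋀ (map (λ a → var (cm a i)) as ++ map (λ b → ¬f var (c b)) bs ++ (¬f var (cm q i) ∷ []))

F₄ : Program → Atom → ℕ → Form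
F₄ P q i = var (ci q i) ⇔f ⋁ (map (λ r → F₃ r i) (filter (λ r → head r ≟ q) P))

T₀ : ℕ → Program → List Form
T₀ k P =
     concatMap (λ q → map (F₁ q) (from 2 count k)) (At P)
  ++ map (F₂ k) (At P)
  ++ concatMap (λ q → map (F₄ P q) (from 1 count (suc k))) (At P)

IsModel : Valuation → List Form → Set
IsModel U T = All (λ F → ⟦ F ⟧ U ≡ true) T

M : Program → Valuation → AtomSet
M P U q = (q ∈ᵇ At P) ∧ U (c q)

MList : Program → Valuation → List Atom
MList P U = deduplicate _≟_ (filter (λ q → Data.Bool.T? (U (c q))) (At P))
  where import Data.Bool

cardM : Program → Valuation → ℕ
cardM P U = length (MList P U)

iU : ℕ → Program → Valuation → ℕ
iU k P U = foldr _⊔_ 0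
  (concatMap (λ q → map (λ i → if U (ci q i) then i else 0) (from 1 count (suc k))) (MList P U))

-- Read c(q,i) as "q is derived at stage i": the formulas F₁–F₄ say that q is derived at
-- stage i exactly when some rule for q fires at i, i.e. its positive body atoms are derived
-- at earlier stages, its negated atoms are not in M(U), and q itself was not derived
-- earlier. So every atom has at most one stage, and if no atom is derived at a stage i ≤ k
-- then no atom is derived at stage i+1 either. Were some atom derived at stage k+1, every
-- stage 1,…,k+1 would therefore be occupied by a different atom of M(U), contradicting
-- |M(U)| ≤ k. Hence all stages are at most k, and a rule of the reduct P^M(U) whose body
-- lies in M(U) would fire at stage k+1 unless its head is already in M(U): M(U) is closed
-- under P^M(U). Conversely, induction on the stage shows that M(U) lies in the least model.
module Submission where

open import Defs
open import Data.Nat using (ℕ; _≤_)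
open import Data.Product using (_×_)

open import Data.Bool using (Bool; true; false; not; _∧_; _∨_; T; T?; if_then_else_)
open import Data.Bool.ListAction using (any; all)
open import Data.Bool.Properties using (T-≡; T-∧)
open import Data.Empty using (⊥-elim)
open import Data.Fin using (Fin; toℕ)
open import Data.Fin.Properties using (toℕ<n; toℕ-injective; injective⇒≤)
open import Data.List using (List; []; _∷_; _++_; map; concatMap; filter; lookup)
open import Data.List.Membership.Propositional using (_∈_; find; lose)
open import Data.List.Membership.Propositional.Properties
  using (∈-map⁺; ∈-map⁻; ∈-upTo⁺; ∈-upTo⁻; ∈-concat⁺′; ∈-++⁺ˡ; ∈-++⁺ʳ;
         ∈-filter⁺; ∈-filter⁻; ∈-deduplicate⁺; ∈-deduplicate⁻)
open import Data.List.Properties using (foldr-preservesᵇ)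
open import Data.List.Relation.Unary.All as All using (All; []; _∷_)
open import Data.List.Relation.Unary.All.Properties using (++⁺; ++⁻; concat⁺)
import Data.List.Relation.Unary.All.Properties as All
open import Data.List.Relation.Unary.Any as Any using (Any; here; there; any?; index)
open import Data.List.Relation.Unary.Any.Properties using (any⇔; lookup-index)
import Data.List.Relation.Unary.Any.Properties as Any
open import Data.Nat using (zero; suc; _+_; _<_; z≤n; s≤s; _≟_)
open import Data.Nat.Induction using (<-wellFounded)
open import Data.Nat.Properties
  using (≡ᵇ⇒≡; ≡⇒≡ᵇ; suc-injective; ≤-refl; ≤-trans; ≤-pred; <⇒≤; n≤1+n; m<n⇒m<1+n;
         m≤n⇒m<n∨m≡n; <-cmp; 1+n≰n; ⊔-lub)
open import Data.Product using (∃-syntax; _,_; proj₁; proj₂)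
open import Data.Sum using (inj₁; inj₂)
open import Data.Unit using (tt)
open import Function using (_∘_; id)
open import Function.Bundles using (_⇔_; mk⇔; Equivalence)
import Function.Properties.Equivalence as ⇔
open import Induction.WellFounded using (Acc; acc)
open import Relation.Binary using (tri<; tri≈; tri>)
open import Relation.Binary.PropositionalEquality using (_≡_; refl; sym; trans; cong; subst)
open import Relation.Nullary using (¬_; Dec; yes; no)
open import Relation.Nullary.Decidable using (decidable-stable)

open Equivalence using (to; from)

T-not⇔¬T : ∀ x → T (not x) ⇔ (¬ T x)
T-not⇔¬T true  = mk⇔ (λ ()) (λ ¬t → ¬t tt)
T-not⇔¬T false = mk⇔ (λ _ ()) (λ _ → tt)

T-all⇔All : ∀ {A : Set} (p : A → Bool) xs → T (all p xs) ⇔ All (T ∘ p) xs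
T-all⇔All p []       = mk⇔ (λ _ → []) (λ _ → tt)
T-all⇔All p (x ∷ xs) = mk⇔
  (λ h → let (px , pxs) = to T-∧ h in px ∷ to (T-all⇔All p xs) pxs)
  (λ { (px ∷ pxs) → from T-∧ (px , from (T-all⇔All p xs) pxs) })

∈ᵇ⇔∈ : ∀ q xs → T (q ∈ᵇ xs) ⇔ (q ∈ xs)
∈ᵇ⇔∈ q xs = mk⇔
  (Any.map (λ {x} e → sym (≡ᵇ⇒≡ x q e)) ∘ from any⇔)
  (to any⇔ ∘ Any.map (λ {x} e → ≡⇒≡ᵇ x q (sym e)))

Any-from1⇔ : ∀ {P : ℕ → Set} n → Any P (from 1 count n) ⇔ (∃[ j ] 1 ≤ j × j < suc n × P j)
Any-from1⇔ n = mk⇔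
  (λ h → let (d , d∈ , pd) = find (Any.map⁻ h) in suc d , s≤s z≤n , s≤s (∈-upTo⁻ d∈) , pd)
  (λ { (suc d , _ , s≤s d<n , pd) → Any.map⁺ (lose (∈-upTo⁺ d<n) pd) })

∈-from⁺ : ∀ a {d n} → d < n → a + d ∈ from a count n
∈-from⁺ a d<n = ∈-map⁺ (a +_) (∈-upTo⁺ d<n)

mapWith∈ : ∀ {A : Set} {P Q : A → Set} {xs} → (∀ {x} → x ∈ xs → P x → Q x) → All P xs → All Q xs
mapWith∈ f ps = All.tabulate (λ x∈ → f x∈ (All.lookup ps x∈))

-- F₃ r (2 + d) does not reduce until pos r is known to be empty or not.
F₃-from-stage-2 : ∀ r d → F₃ r (2 + d) ≡ ⋀ (map (λ a → var (cm a (2 + d))) (pos r)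
                                          ++ map (λ b → ¬f var (c b)) (neg r)
                                          ++ (¬f var (cm (head r) (2 + d)) ∷ []))
F₃-from-stage-2 (_ ← []    ∣ _) _ = refl
F₃-from-stage-2 (_ ← _ ∷ _ ∣ _) _ = refl

module _ (U : Valuation) where

  ⟦⇔⟧ : ∀ F G → T (⟦ F ⇔f G ⟧ U) → T (⟦ F ⟧ U) ⇔ T (⟦ G ⟧ U)
  ⟦⇔⟧ F G h with ⟦ F ⟧ U | ⟦ G ⟧ U
  ⟦⇔⟧ F G _  | true  | true  = mk⇔ id id
  ⟦⇔⟧ F G () | true  | false
  ⟦⇔⟧ F G () | false | true
  ⟦⇔⟧ F G _  | false | false = mk⇔ id id

  ⟦⋁-map⟧≡any : ∀ {A : Set} (f : A → Form) xs → ⟦ ⋁ (map f xs) ⟧ U ≡ any (λ x → ⟦ f x ⟧ U) xs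
  ⟦⋁-map⟧≡any f []       = refl
  ⟦⋁-map⟧≡any f (x ∷ xs) = cong (⟦ f x ⟧ U ∨_) (⟦⋁-map⟧≡any f xs)

  ⟦⋀⟧≡all : ∀ Fs → ⟦ ⋀ Fs ⟧ U ≡ all (λ F → ⟦ F ⟧ U) Fs
  ⟦⋀⟧≡all []       = refl
  ⟦⋀⟧≡all (F ∷ Fs) = cong (⟦ F ⟧ U ∧_) (⟦⋀⟧≡all Fs)

  ⟦⋁-map⟧ : ∀ {A : Set} (f : A → Form) xs → T (⟦ ⋁ (map f xs) ⟧ U) ⇔ Any (λ x → T (⟦ f x ⟧ U)) xs
  ⟦⋁-map⟧ f xs rewrite ⟦⋁-map⟧≡any f xs = mk⇔ (from any⇔) (to any⇔)

  ⟦⋀⟧ : ∀ Fs → T (⟦ ⋀ Fs ⟧ U) ⇔ All (λ F → T (⟦ F ⟧ U)) Fs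
  ⟦⋀⟧ Fs rewrite ⟦⋀⟧≡all Fs = T-all⇔All (λ F → ⟦ F ⟧ U) Fs

module _ {P : Program} where

  ∈-At⁺ : ∀ {r a} → r ∈ P → a ∈ head r ∷ pos r ++ neg r → a ∈ At P
  ∈-At⁺ r∈P a∈r = ∈-concat⁺′ a∈r (∈-map⁺ _ r∈P)

  head∈At : ∀ {r} → r ∈ P → head r ∈ At P
  head∈At r∈P = ∈-At⁺ r∈P (here refl)

  pos⊆At : ∀ {r a} → r ∈ P → a ∈ pos r → a ∈ At P
  pos⊆At r∈P a∈ = ∈-At⁺ r∈P (there (∈-++⁺ˡ a∈))

  neg⊆At : ∀ {r b} → r ∈ P → b ∈ neg r → b ∈ At P
  neg⊆At {r} r∈P b∈ = ∈-At⁺ r∈P (there (∈-++⁺ʳ (pos r) b∈))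

module MProperties (P : Program) (U : Valuation) where

  ∈-MList⁺ : ∀ {q} → q ∈ At P → T (U (c q)) → q ∈ MList P U
  ∈-MList⁺ q∈ s = ∈-deduplicate⁺ _≟_ (∈-filter⁺ (λ q → T? (U (c q))) q∈ s)

  ∈-MList⁻ : ∀ {q} → q ∈ MList P U → q ∈ At P
  ∈-MList⁻ q∈ = proj₁ (∈-filter⁻ (λ q → T? (U (c q))) (∈-deduplicate⁻ _≟_ _ q∈))

  M-on-At : ∀ {q} → q ∈ At P → M P U q ≡ U (c q)
  M-on-At {q} q∈ = cong (_∧ U (c q)) (to T-≡ (from (∈ᵇ⇔∈ q (At P)) q∈))

  T-M⇔ : ∀ {q} → T (M P U q) ⇔ (q ∈ At P × T (U (c q)))
  T-M⇔ {q} = mk⇔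
    (λ h → let (q∈ᵇ , s) = to T-∧ h in to (∈ᵇ⇔∈ q (At P)) q∈ᵇ , s)
    (λ { (q∈ , s) → subst T (sym (M-on-At q∈)) s })

  survives⇔ : ∀ {r} → r ∈ P →
              T (all (λ b → not (M P U b)) (neg r)) ⇔ All (λ b → T (not (U (c b)))) (neg r)
  survives⇔ {r} r∈ = ⇔.trans (T-all⇔All _ (neg r)) (mk⇔
    (mapWith∈ (λ b∈ → subst (T ∘ not) (M-on-At (neg⊆At r∈ b∈))))
    (mapWith∈ (λ b∈ → subst (T ∘ not) (sym (M-on-At (neg⊆At r∈ b∈))))))

  private
    survives? : ∀ r → Dec (T (all (λ b → not (M P U b)) (neg r)))
    survives? r = T? (all (λ b → not (M P U b)) (neg r))

  ∈-reduct⁺ : ∀ {r} → r ∈ P → All (λ b → T (not (U (c b)))) (neg r) →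
              (head r ⇐ pos r) ∈ reduct P (M P U)
  ∈-reduct⁺ r∈ negs =
    ∈-map⁺ _ (∈-filter⁺ survives? r∈ (from (survives⇔ r∈) negs))

  ∈-reduct⁻ : ∀ {r′} → r′ ∈ reduct P (M P U) →
              ∃[ r ] r ∈ P × r′ ≡ (head r ⇐ pos r) × All (λ b → T (not (U (c b)))) (neg r)
  ∈-reduct⁻ r′∈ with ∈-map⁻ _ r′∈
  ... | r , r∈kept , refl with ∈-filter⁻ survives? r∈kept
  ... | r∈ , survives = r , r∈ , refl , to (survives⇔ r∈) survives

module _ (k : ℕ) (P : Program) (U : Valuation) (model : IsModel U (T₀ k P)) where

  open MProperties P U

  Staged : Atom → ℕ → Set
  Staged q i = T (U (ci q i))

  -- T₀ says nothing about c(q,0), hence the lower bound 1 ≤ j.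
  StagedBefore : Atom → ℕ → Set
  StagedBefore q i = ∃[ j ] 1 ≤ j × j < i × Staged q j

  Fires : Rule → ℕ → Set
  Fires r i = All (λ a → StagedBefore a i) (pos r)
            × All (λ b → T (not (U (c b)))) (neg r)
            × ¬ StagedBefore (head r) i

  Supported : Atom → ℕ → Set
  Supported q i = ∃[ r ] r ∈ P × head r ≡ q × Fires r i

  NoneStaged : ℕ → Set
  NoneStaged i = ∀ {q} → q ∈ At P → ¬ Staged q i

  private
    holds : ∀ {F} → F ∈ T₀ k P → T (⟦ F ⟧ U)
    holds F∈ = from T-≡ (All.lookup model F∈)

    F₁s F₂s : List Form
    F₁s = concatMap (λ q → map (F₁ q) (from 2 count k)) (At P)
    F₂s = map (F₂ k) (At P)

    F₁-holds : ∀ {q d} → q ∈ At P → d < k → T (⟦ F₁ q (2 + d) ⟧ U)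
    F₁-holds {q} q∈ d<k = holds (∈-++⁺ˡ
      (∈-concat⁺′ (∈-map⁺ (F₁ q) (∈-from⁺ 2 d<k)) (∈-map⁺ (λ q → map (F₁ q) (from 2 count k)) q∈)))

    F₂-holds : ∀ {q} → q ∈ At P → T (⟦ F₂ k q ⟧ U)
    F₂-holds q∈ = holds (∈-++⁺ʳ F₁s (∈-++⁺ˡ (∈-map⁺ (F₂ k) q∈)))

    F₄-holds : ∀ {q d} → q ∈ At P → d < suc k → T (⟦ F₄ P q (1 + d) ⟧ U)
    F₄-holds {q} q∈ d<1+k = holds (∈-++⁺ʳ F₁s (∈-++⁺ʳ F₂s
      (∈-concat⁺′ (∈-map⁺ (F₄ P q) (∈-from⁺ 1 d<1+k))
                  (∈-map⁺ (λ q → map (F₄ P q) (from 1 count suc k)) q∈))))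

  ⇔-stage-disjunction : ∀ {x q} n →
                        T (⟦ var x ⇔f ⋁ (map (λ j → var (ci q j)) (from 1 count n)) ⟧ U) →
                        T (U x) ⇔ StagedBefore q (suc n)
  ⇔-stage-disjunction {x} {q} n h =
    ⇔.trans (⟦⇔⟧ U (var x) (⋁ (map stage (from 1 count n))) h)
      (⇔.trans (⟦⋁-map⟧ U stage (from 1 count n)) (Any-from1⇔ n))
    where
      stage : ℕ → Form
      stage j = var (ci q j)

  c⁻-meaning : ∀ {q i} → q ∈ At P → 2 ≤ i → i ≤ suc k → T (U (cm q i)) ⇔ StagedBefore q i
  c⁻-meaning {i = suc (suc d)} q∈ (s≤s (s≤s z≤n)) (s≤s d<k) =
    ⇔-stage-disjunction (suc d) (F₁-holds q∈ d<k)

  c-meaning : ∀ {q} → q ∈ At P → T (U (c q)) ⇔ StagedBefore q (2 + k)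
  c-meaning q∈ = ⇔-stage-disjunction (suc k) (F₂-holds q∈)

  nothing-before-stage-1 : ∀ {q} → ¬ StagedBefore q 1
  nothing-before-stage-1 (_ , s≤s z≤n , s≤s () , _)

  F₃-meaning : ∀ {r i} → r ∈ P → 1 ≤ i → i ≤ suc k → T (⟦ F₃ r i ⟧ U) ⇔ Fires r i
  F₃-meaning {_ ← []    ∣ _} {1} _ _ _ = mk⇔
    (λ h → [] , All.map⁻ (to (⟦⋀⟧ U _) h) , nothing-before-stage-1)
    (λ { (_ , negs , _) → from (⟦⋀⟧ U _) (All.map⁺ negs) })
  F₃-meaning {_ ← _ ∷ _ ∣ _} {1} _ _ _ =
    mk⇔ (λ ()) (λ { ((before ∷ _) , _) → nothing-before-stage-1 before })
  F₃-meaning {r} {suc (suc d)} r∈ _ i≤ rewrite F₃-from-stage-2 r d =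
    ⇔.trans (⟦⋀⟧ U _) (mk⇔ fires fired)
    where
      c⁻ : ∀ {a} → a ∈ At P → T (U (cm a (2 + d))) ⇔ StagedBefore a (2 + d)
      c⁻ a∈ = c⁻-meaning a∈ (s≤s (s≤s z≤n)) i≤

      positives negatives : List Form
      positives = map (λ a → var (cm a (2 + d))) (pos r)
      negatives = map (λ b → ¬f var (c b)) (neg r)

      Body : Set
      Body = All (λ F → T (⟦ F ⟧ U)) (positives ++ negatives ++ (¬f var (cm (head r) (2 + d)) ∷ []))

      fires : Body → Fires r (2 + d)
      fires h with ++⁻ positives h
      ... | before , h′ with ++⁻ negatives h′
      ... | negs , fresh ∷ [] =
        mapWith∈ (λ a∈ → to (c⁻ (pos⊆At r∈ a∈))) (All.map⁻ before) ,
        All.map⁻ negs ,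
        to (T-not⇔¬T _) fresh ∘ from (c⁻ (head∈At r∈))

      fired : Fires r (2 + d) → Body
      fired (before , negs , fresh) =
        ++⁺ (All.map⁺ (mapWith∈ (λ a∈ → from (c⁻ (pos⊆At r∈ a∈))) before))
            (++⁺ (All.map⁺ negs) (from (T-not⇔¬T _) (fresh ∘ to (c⁻ (head∈At r∈))) ∷ []))

  staged⇔supported : ∀ {q i} → q ∈ At P → 1 ≤ i → i ≤ suc k → Staged q i ⇔ Supported q i
  staged⇔supported {q} {suc d} q∈ _ i≤ =
    ⇔.trans (⟦⇔⟧ U (var (ci q (1 + d))) (⋁ (map (λ r → F₃ r (1 + d)) rules)) (F₄-holds q∈ i≤))
      (⇔.trans (⟦⋁-map⟧ U (λ r → F₃ r (1 + d)) rules) (mk⇔ supported supporting))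
    where
      rules : List Rule
      rules = filter (λ r → head r ≟ q) P

      supported : Any (λ r → T (⟦ F₃ r (1 + d) ⟧ U)) rules → Supported q (1 + d)
      supported h with find h
      ... | r , r∈rules , f with ∈-filter⁻ (λ r → head r ≟ q) r∈rules
      ... | r∈ , r→q = r , r∈ , r→q , to (F₃-meaning r∈ (s≤s z≤n) i≤) f

      supporting : Supported q (1 + d) → Any (λ r → T (⟦ F₃ r (1 + d) ⟧ U)) rules
      supporting (r , r∈ , r→q , f) =
        lose (∈-filter⁺ (λ r → head r ≟ q) r∈ r→q) (from (F₃-meaning r∈ (s≤s z≤n) i≤) f)

  staged-once : ∀ {q i j} → q ∈ At P → 1 ≤ i → i < j → j ≤ suc k → Staged q i → ¬ Staged q j
  staged-once q∈ 1≤i i<j j≤ si sj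
    with to (staged⇔supported q∈ (≤-trans 1≤i (<⇒≤ i<j)) j≤) sj
  ... | _ , _ , refl , (_ , _ , fresh) = fresh (_ , 1≤i , i<j , si)

  staged-unique : ∀ {q i j} → q ∈ At P → 1 ≤ i → 1 ≤ j → i ≤ suc k → j ≤ suc k →
                  Staged q i → Staged q j → i ≡ j
  staged-unique {i = i} {j} q∈ 1≤i 1≤j i≤ j≤ si sj with <-cmp i j
  ... | tri< i<j _ _ = ⊥-elim (staged-once q∈ 1≤i i<j j≤ si sj)
  ... | tri≈ _ i≡j _ = i≡j
  ... | tri> _ _ j<i = ⊥-elim (staged-once q∈ 1≤j j<i i≤ sj si)

  staged-before-suc : ∀ {q i} → StagedBefore q i → StagedBefore q (suc i)
  staged-before-suc (j , 1≤j , j<i , s) = j , 1≤j , m<n⇒m<1+n j<i , s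

  staged-before-pred : ∀ {q i} → StagedBefore q (suc i) → ¬ Staged q i → StagedBefore q i
  staged-before-pred (j , 1≤j , s≤s j≤i , s) ¬si with m≤n⇒m<n∨m≡n j≤i
  ... | inj₁ j<i  = j , 1≤j , j<i , s
  ... | inj₂ refl = ⊥-elim (¬si s)

  fires-earlier : ∀ {r i} → r ∈ P → NoneStaged i → Fires r (suc i) → Fires r i
  fires-earlier r∈ none (before , negs , fresh) =
    mapWith∈ (λ a∈ sb → staged-before-pred sb (none (pos⊆At r∈ a∈))) before ,
    negs ,
    fresh ∘ staged-before-suc

  gap-propagates : ∀ {i} → 1 ≤ i → i ≤ k → NoneStaged i → NoneStaged (suc i)
  gap-propagates 1≤i i≤k none q∈ s with to (staged⇔supported q∈ (s≤s z≤n) (s≤s i≤k)) s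
  ... | r , r∈ , refl , fires =
    none (head∈At r∈) (from (staged⇔supported (head∈At r∈) 1≤i (≤-trans i≤k (n≤1+n k)))
                            (r , r∈ , refl , fires-earlier r∈ none fires))

  gap-persists : ∀ {i} → 1 ≤ i → NoneStaged i → ∀ j → i ≤ j → j ≤ suc k → NoneStaged j
  gap-persists (s≤s _) none zero () _
  gap-persists 1≤i none (suc j) i≤1+j 1+j≤ with m≤n⇒m<n∨m≡n i≤1+j
  ... | inj₂ refl       = none
  ... | inj₁ (s≤s i≤j) =
    gap-propagates (≤-trans 1≤i i≤j) (≤-pred 1+j≤)
      (gap-persists 1≤i none j i≤j (≤-trans (n≤1+n j) 1+j≤))

  stages-occupied-below : ∀ {q i} → q ∈ At P → Staged q (suc k) → 1 ≤ i → i ≤ suc k →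
                          ∃[ p ] p ∈ At P × Staged p i
  stages-occupied-below {i = i} q∈ s 1≤i i≤ with any? (λ p → T? (U (ci p i))) (At P)
  ... | yes some = find some
  ... | no  none =
    ⊥-elim (gap-persists 1≤i (λ p∈ sp → none (lose p∈ sp)) (suc k) i≤ ≤-refl q∈ s)

  staged⇒derivable : ∀ {q i} → Acc _<_ i → q ∈ At P → 1 ≤ i → i ≤ suc k → Staged q i →
                     LeastModel (reduct P (M P U)) q
  staged⇒derivable {i = i} (acc earlier) q∈ 1≤i i≤ s
    with to (staged⇔supported q∈ 1≤i i≤) s
  ... | r , r∈ , refl , (before , negs , _) = byRule (∈-reduct⁺ r∈ negs) (mapWith∈ derive before)
    where
      derive : ∀ {a} → a ∈ pos r → StagedBefore a i → LeastModel (reduct P (M P U)) a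
      derive a∈ (j , 1≤j , j<i , sj) =
        staged⇒derivable (earlier j<i) (pos⊆At r∈ a∈) 1≤j (≤-trans (<⇒≤ j<i) i≤) sj

  module _ (few : cardM P U ≤ k) where

    top-stage-empty : NoneStaged (suc k)
    top-stage-empty {q} q∈ s = 1+n≰n (≤-trans (injective⇒≤ index-injective) few)
      where
        witness : (i : Fin (suc k)) → ∃[ p ] p ∈ At P × Staged p (suc (toℕ i))
        witness i = stages-occupied-below q∈ s (s≤s z≤n) (toℕ<n i)

        listed : (i : Fin (suc k)) → proj₁ (witness i) ∈ MList P U
        listed i with witness i
        ... | p , p∈ , sp = ∈-MList⁺ p∈ (from (c-meaning p∈) (_ , s≤s z≤n , s≤s (toℕ<n i) , sp))

        index-injective : ∀ {i j} → index (listed i) ≡ index (listed j) → i ≡ j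
        index-injective {i} {j} same-index =
          toℕ-injective (suc-injective
            (staged-unique p∈ (s≤s z≤n) (s≤s z≤n) (toℕ<n i) (toℕ<n j) si sj))
          where
            p = proj₁ (witness i)
            p∈ = proj₁ (proj₂ (witness i))
            si = proj₂ (proj₂ (witness i))

            same-atom : proj₁ (witness j) ≡ p
            same-atom = trans (lookup-index (listed j))
                          (trans (cong (lookup (MList P U)) (sym same-index))
                                 (sym (lookup-index (listed i))))

            sj : Staged p (suc (toℕ j))
            sj = subst (λ p → Staged p (suc (toℕ j))) same-atom (proj₂ (proj₂ (witness j)))

    iU≤k : iU k P U ≤ k
    iU≤k = foldr-preservesᵇ {P = _≤ k} ⊔-lub z≤n
      (concat⁺ (All.map⁺ {f = entries} (All.tabulate λ q∈ → All.map⁺ (All.tabulate (entry≤k q∈)))))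
      where
        entries : Atom → List ℕ
        entries q = map (λ i → if U (ci q i) then i else 0) (from 1 count suc k)

        entry≤k : ∀ {q i} → q ∈ MList P U → i ∈ from 1 count (suc k) →
                  (if U (ci q i) then i else 0) ≤ k
        entry≤k {q} q∈ i∈ with ∈-map⁻ (1 +_) i∈
        ... | d , d∈ , refl with U (ci q (suc d)) in staged
        ...   | false = z≤n
        ...   | true with m≤n⇒m<n∨m≡n (≤-pred (∈-upTo⁻ d∈))
        ...     | inj₁ d<k  = d<k
        ...     | inj₂ refl = ⊥-elim (top-stage-empty (∈-MList⁻ q∈) (from T-≡ staged))

    M-closed : ∀ {r} → r ∈ P → All (λ a → T (U (c a))) (pos r) →
               All (λ b → T (not (U (c b)))) (neg r) → T (U (c (head r)))
    M-closed {r} r∈ body-in negs = decidable-stable (T? _) λ head-out →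
      top-stage-empty h∈ (from (staged⇔supported h∈ (s≤s z≤n) ≤-refl)
        (r , r∈ , refl , mapWith∈ (λ a∈ → below-top (pos⊆At r∈ a∈)) body-in , negs ,
         head-out ∘ from (c-meaning h∈) ∘ staged-before-suc))
      where
        h∈ : head r ∈ At P
        h∈ = head∈At r∈

        below-top : ∀ {a} → a ∈ At P → T (U (c a)) → StagedBefore a (suc k)
        below-top a∈ s = staged-before-pred (to (c-meaning a∈) s) (top-stage-empty a∈)

    mutual
      derivable⇒M : ∀ {q} → LeastModel (reduct P (M P U)) q → q ∈ At P × T (U (c q))
      derivable⇒M (byRule r′∈ body) with ∈-reduct⁻ r′∈
      ... | r , r∈ , refl , negs = head∈At r∈ , M-closed r∈ (all-derivable⇒M body) negs

      all-derivable⇒M : ∀ {as} → All (LeastModel (reduct P (M P U))) as →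
                        All (λ a → T (U (c a))) as
      all-derivable⇒M []       = []
      all-derivable⇒M (d ∷ ds) = proj₂ (derivable⇒M d) ∷ all-derivable⇒M ds

    M-stable : StableModel P (M P U)
    M-stable q = mk⇔ derive (to T-≡ ∘ from T-M⇔ ∘ derivable⇒M)
      where
        derive : M P U q ≡ true → LeastModel (reduct P (M P U)) q
        derive q∈M with to T-M⇔ (from T-≡ q∈M)
        ... | q∈ , s with to (c-meaning q∈) s
        ...   | j , 1≤j , j<2+k , sj =
          staged⇒derivable (<-wellFounded j) q∈ 1≤j (≤-pred j<2+k) sj

mainTheorem8 : (k : ℕ) (P : Program) (U : Valuation) →
    IsModel U (T₀ k P) → cardM P U ≤ k →
    (iU k P U ≤ k) × StableModel P (M P U)
mainTheorem8 k P U model few = iU≤k k P U model few , M-stable k P U model few
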